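{- For each predicate $Q$ on $\mathbb{N}^*$ and each finite type $\rho$, $$\mathrm{HA}^{\omega} \vdash \forall g^{\mathbb{N} \to \rho^{\dagger}} \left[ \forall n^{\mathbb{N}}\, P^{Q}_{\rho}(g(n)) \to P^{Q}_{\mathbb{N} \to \rho}(\mathsf{KE}_{\rho}(g)) \right].$$
   Context: $\mathrm{HA}^{\omega}$ is extensional Heyting arithmetic in all finite types (terms of Gödel's system $\mathsf{T}$); finite sequences ($\mathbb{N}^*$) are coded as naturals, $*$ is concatenation, $\langle n\rangle$ a singleton, $\dot-$ cut-off subtraction, $\mathrm{sg}$ the signum function. Types are translated by $\mathbb{N}^\dagger := \mathbb{N}^*\to\mathbb{N}$ and $(\rho\to\sigma)^\dagger := \rho^\dagger\to\sigma^\dagger$. Define $\mathsf{KE}_{\mathbb{N}} := \lambda f^{\mathbb{N} \to \mathbb{N}^\dagger}. \lambda \gamma^{\mathbb{N}^\dagger}.\lambda a^{\mathbb{N}^{*}}. \mathrm{sg}(\gamma(a)) \cdot f(\gamma(a) \dot- 1)(a)$ and $\mathsf{KE}_{\rho \to \sigma} := \lambda f^{\mathbb{N} \to \rho^\dagger \to \sigma^\dagger}. \lambda u^{\mathbb{N}^\dagger}. \lambda v^{\rho^\dagger}. \mathsf{KE}_{\sigma}(\lambda x^{\mathbb{N}}. fxv)u$. A neighbourhood function is $\gamma\colon\mathbb{N}^*\to\mathbb{N}$ with $\forall\alpha\exists n\,\gamma(\overline{\alpha}n)>0$ and $\forall a[\gamma(a)>0\to\forall b\,\gamma(a*b)=\gamma(a)]$;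 write $S_\gamma(a)\equiv\gamma(a)>0$, and $\mathrm{Ind}(Q)\equiv\forall a^{\mathbb{N}^*}[\forall n^{\mathbb{N}}Q(a*\langle n\rangle)\to Q(a)]$. For a predicate $Q$ on $\mathbb{N}^*$, define $P^Q_\rho$ on $\rho^\dagger$ by induction on types: $P^{Q}_{\mathbb{N}}(\gamma)$ iff $\gamma$ is a neighbourhood function and $\forall a^{\mathbb{N}^{*}} [ \forall b^{\mathbb{N}^{*}} [S_{\gamma}(a*b) \to Q(a*b)] \wedge \mathrm{Ind}(Q) \to Q(a)]$; $P^{Q}_{\rho \to \sigma}(G)$ iff $\forall x^{\rho^{\dagger}} [ P^{Q}_{\rho}(x) \to P^{Q}_{\sigma}(Gx)]$. -}

module Defs where

open import Data.Nat using (ℕ; zero; suc; _*_; _∸_; _>_)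
open import Data.List using (List; _++_; map; upTo; [_])
open import Data.Product using (_×_; ∃)
open import Relation.Binary.PropositionalEquality using (_≡_)

-- Finite sequences ℕ* are represented by lists of naturals; _++_ is concatenation *.
Seq : Set
Seq = List ℕ

sg : ℕ → ℕ
sg zero    = 0
sg (suc _) = 1

data Ty : Set where
  ι   : Ty
  _⇒_ : Ty → Ty → Ty

infixr 5 _⇒_

_† : Ty → Set
ι †       = Seq → ℕ
(ρ ⇒ σ) † = ρ † → σ †


KE : (ρ : Ty) → (ℕ → ρ †) → ι † → ρ †
KE ι       f γ a = sg (γ a) * f (γ a ∸ 1) a
KE (ρ ⇒ σ) f u v = KE σ (λ x → f x v) u

initSeg : (ℕ → ℕ) → ℕ → Seq
initSeg α n = map α (upTo n)

S : (Seq → ℕ) → Seq → Set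
S γ a = γ a > 0

IsNbhdFun : (Seq → ℕ) → Set
IsNbhdFun γ =
  (∀ (α : ℕ → ℕ) → ∃ λ n → γ (initSeg α n) > 0)
  × (∀ a → γ a > 0 → ∀ b → γ (a ++ b) ≡ γ a)

Ind : (Seq → Set) → Set
Ind Q = ∀ a → (∀ (n : ℕ) → Q (a ++ [ n ])) → Q a

P : (Q : Seq → Set) → (ρ : Ty) → ρ † → Set
P Q ι γ = IsNbhdFun γ
        × (∀ a → (∀ b → S γ (a ++ b) → Q (a ++ b)) × Ind Q → Q a)
P Q (ρ ⇒ σ) G = ∀ (x : ρ †) → P Q ρ x → P Q σ (G x)

-- Where γ is positive, say γ a = k + 1, the function KE g γ agrees with g k on every extension
-- of a.  So KE g γ is a neighbourhood function: along a path α it becomes positive once γ has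
-- fixed some k and g k has become positive as well.  For bar induction, securing Q on the
-- extensions of a where KE g γ is positive secures it, at each node b where γ is positive with
-- value k + 1, on the extensions where g k is positive; the bar property of g k gives Q at b,
-- and the bar property of γ then gives Q at a.  Higher types reduce to ι pointwise.
module Submission where

open import Defs
open import Data.Nat using (ℕ; suc; _≤_; _≤′_; _>_; _⊔_; s≤s; z≤n; ≤′-refl; ≤′-step)
open import Data.Nat.Properties using (+-identityʳ; ≤⇒≤′; m≤m⊔n; m≤n⊔m)
open import Data.List using ([]; _++_; map; upTo; [_])
open import Data.List.Properties using (upTo-∷ʳ; map-++; ++-assoc; ++-identityʳ)
open import Data.Product using (_×_; ∃; _,_; proj₁; proj₂)
open import Relation.Binary.PropositionalEquality using (_≡_; refl; sym; trans; cong; subst; module ≡-Reasoning)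

pos⇒suc : ∀ {n} → n > 0 → ∃ λ k → n ≡ suc k
pos⇒suc {suc k} _ = k , refl

suc>0 : ∀ {n k} → n ≡ suc k → n > 0
suc>0 refl = s≤s z≤n

initSeg-suc : ∀ (α : ℕ → ℕ) n → initSeg α (suc n) ≡ initSeg α n ++ [ α n ]
initSeg-suc α n = begin
  map α (upTo (suc n))         ≡⟨ cong (map α) (sym (upTo-∷ʳ n)) ⟩
  map α (upTo n ++ [ n ])      ≡⟨ map-++ α (upTo n) [ n ] ⟩
  initSeg α n ++ [ α n ]       ∎
  where open ≡-Reasoning

initSeg-extends′ : ∀ (α : ℕ → ℕ) {m n} → m ≤′ n → ∃ λ b → initSeg α n ≡ initSeg α m ++ b
initSeg-extends′ α {m} ≤′-refl = [] , sym (++-identityʳ (initSeg α m))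
initSeg-extends′ α {m} (≤′-step {n} m≤′n) with initSeg-extends′ α m≤′n
... | b , eq = b ++ [ α n ] , (begin
  initSeg α (suc n)              ≡⟨ initSeg-suc α n ⟩
  initSeg α n ++ [ α n ]         ≡⟨ cong (_++ [ α n ]) eq ⟩
  (initSeg α m ++ b) ++ [ α n ]  ≡⟨ ++-assoc (initSeg α m) b [ α n ] ⟩
  initSeg α m ++ (b ++ [ α n ])  ∎)
  where open ≡-Reasoning

initSeg-extends : ∀ (α : ℕ → ℕ) {m n} → m ≤ n → ∃ λ b → initSeg α n ≡ initSeg α m ++ b
initSeg-extends α m≤n = initSeg-extends′ α (≤⇒≤′ m≤n)

module _ {γ : ι †} (nbhd : IsNbhdFun γ) where

  nbhd-bar : ∀ α → ∃ λ n → γ (initSeg α n) > 0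
  nbhd-bar = proj₁ nbhd

  nbhd-++ : ∀ {a k} → γ a ≡ suc k → ∀ b → γ (a ++ b) ≡ suc k
  nbhd-++ {a} γa≡ b = trans (proj₂ nbhd a (suc>0 γa≡) b) γa≡

  nbhd-initSeg-≤ : ∀ α {m n} → m ≤ n → γ (initSeg α m) > 0 → γ (initSeg α n) ≡ γ (initSeg α m)
  nbhd-initSeg-≤ α m≤n pos with initSeg-extends α m≤n
  ... | b , eq = trans (cong γ eq) (proj₂ nbhd _ pos b)

module _ (g : ℕ → ι †) (γ : ι †) where

  KE-ι-suc : ∀ {a k} → γ a ≡ suc k → KE ι g γ a ≡ g k a
  KE-ι-suc {a} {k} γa≡ rewrite γa≡ = +-identityʳ (g k a)

  KE-ι-pos : ∀ {a} → KE ι g γ a > 0 → γ a > 0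
  KE-ι-pos {a} pos with γ a
  ... | suc _ = s≤s z≤n

  KE-ι-agrees : IsNbhdFun γ → ∀ {a k} → γ a ≡ suc k → ∀ b → KE ι g γ (a ++ b) ≡ g k (a ++ b)
  KE-ι-agrees nbhd γa≡ b = KE-ι-suc (nbhd-++ nbhd γa≡ b)

  KE-isNbhdFun : IsNbhdFun γ → (∀ k → IsNbhdFun (g k)) → IsNbhdFun (KE ι g γ)
  KE-isNbhdFun nbhd g-nbhd = bar , stable
    where
      bar : ∀ α → ∃ λ n → KE ι g γ (initSeg α n) > 0
      bar α with nbhd-bar nbhd α
      ... | n , γpos with pos⇒suc γpos
      ... | k , γn≡ with nbhd-bar (g-nbhd k) α
      ... | m , gpos with initSeg-extends α (m≤m⊔n n m)
      ... | b , eq = n ⊔ m , subst (_> 0) (sym KE≡g) (subst (_> 0) (sym g≡) gpos)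
        where
          KE≡g : KE ι g γ (initSeg α (n ⊔ m)) ≡ g k (initSeg α (n ⊔ m))
          KE≡g rewrite eq = KE-ι-agrees nbhd γn≡ b
          g≡ : g k (initSeg α (n ⊔ m)) ≡ g k (initSeg α m)
          g≡ = nbhd-initSeg-≤ (g-nbhd k) α (m≤n⊔m n m) gpos

      stable : ∀ a → KE ι g γ a > 0 → ∀ b → KE ι g γ (a ++ b) ≡ KE ι g γ a
      stable a pos b with pos⇒suc (KE-ι-pos pos)
      ... | k , γa≡ = begin
        KE ι g γ (a ++ b)  ≡⟨ KE-ι-agrees nbhd γa≡ b ⟩
        g k (a ++ b)       ≡⟨ proj₂ (g-nbhd k) a (subst (_> 0) (KE-ι-suc γa≡) pos) b ⟩
        g k a              ≡⟨ sym (KE-ι-suc γa≡) ⟩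
        KE ι g γ a         ∎
        where open ≡-Reasoning

module _ (Q : Seq → Set) where

  Secures : ι † → Seq → Set
  Secures f a = ∀ b → S f (a ++ b) → Q (a ++ b)

  Bars : ι † → Set
  Bars f = ∀ a → Secures f a × Ind Q → Q a

  secures-++ : ∀ f {a} → Secures f a → ∀ b → Secures f (a ++ b)
  secures-++ f {a} sec b c pos =
    subst Q (sym (++-assoc a b c)) (sec (b ++ c) (subst (λ x → S f x) (++-assoc a b c) pos))

  secures-agree : ∀ f f′ {a} → (∀ b → f (a ++ b) ≡ f′ (a ++ b)) → Secures f a → Secures f′ a
  secures-agree _ _ f≡f′ sec b pos = sec b (subst (_> 0) (sym (f≡f′ b)) pos)

  KE-bars : ∀ (g : ℕ → ι †) {γ} → IsNbhdFun γ → Bars γ → (∀ k → Bars (g k)) → Bars (KE ι g γ)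
  KE-bars g {γ} nbhd γ-bars g-bars a (sec , ind) = γ-bars a (γ-sec , ind)
    where
      γ-sec : Secures γ a
      γ-sec b pos with pos⇒suc pos
      ... | k , γab≡ = g-bars k (a ++ b)
        (secures-agree (KE ι g γ) (g k) (KE-ι-agrees g γ nbhd γab≡)
          (secures-++ (KE ι g γ) sec b) , ind)

lemma5p3 : (Q : Seq → Set) (ρ : Ty) (g : ℕ → ρ †)
    → (∀ (n : ℕ) → P Q ρ (g n))
    → P Q (ι ⇒ ρ) (KE ρ g)
lemma5p3 Q ι g Pg γ (γ-nbhd , γ-bars) =
  KE-isNbhdFun g γ γ-nbhd (λ k → proj₁ (Pg k)) , KE-bars Q g γ-nbhd γ-bars (λ k → proj₂ (Pg k))
lemma5p3 Q (ρ ⇒ σ) g Pg u Pu v Pv = lemma5p3 Q σ (λ x → g x v) (λ n → Pg n v Pv) u Pu
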